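{- In the $p$-processor cup game on $n$ cups, if the emptier follows the greedy algorithm, then against every filler strategy the fill of every cup after every step is at most $O(p + \log n)$ (with an absolute hidden constant).
   Context: The $p$-processor cup game on $n$ cups: there are $n$ cups, each holding a nonnegative real amount of water (its fill), all initially empty. In each step, the filler first distributes up to $p$ units of water among the cups, placing at most $1$ unit into any single cup; then the emptier selects $p$ cups and removes up to $1$ unit of water from each of them. The backlog is the fill of the fullest cup. The greedy algorithm for the emptier: in each step, after the filler has placed water, remove $1$ unit of water from each of the $p$ fullest cups (removing all of a cup's water if it contains less than $1$ unit); ties are broken arbitrarily.
   Formalization: The amounts of water the filler places are rational rather than real, so the fills of the cups are rational as well. -}

module Defs where

open import Data.Nat as ℕ using (ℕ; suc)
open import Data.Integer using (+_)
open import Data.Rational using (ℚ; 0ℚ; 1ℚ; _+_; _-_; _⊔_; _≤_; _/_)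
open import Data.Fin using (Fin)
open import Data.Fin.Subset using (Subset; _∈_; _∉_; ∣_∣)
open import Data.Vec using (lookup)
open import Data.Bool using (Bool; true; false; if_then_else_)
open import Data.Product using (Σ; _×_)
open import Relation.Binary.PropositionalEquality using (_≡_)

ℕtoℚ : ℕ → ℚ
ℕtoℚ k = + k / 1

Fills : ℕ → Set
Fills n = Fin n → ℚ

sumFin : ∀ {n} → (Fin n → ℚ) → ℚ
sumFin {ℕ.zero} f = 0ℚ
sumFin {suc n} f = f Fin.zero + sumFin (λ i → f (Fin.suc i))
  where import Data.Fin as Fin

ValidFill : (n p : ℕ) → (Fin n → ℚ) → Set
ValidFill n p a = ((i : Fin n) → (0ℚ ≤ a i) × (a i ≤ 1ℚ)) × (sumFin a ≤ ℕtoℚ p)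

GreedyChoice : (n p : ℕ) → Fills n → Subset n → Set
GreedyChoice n p f S =
  (∣ S ∣ ≡ p) × ((i j : Fin n) → i ∈ S → j ∉ S → f j ≤ f i)

empty : ∀ {n} → Fills n → Subset n → Fills n
empty f S i = if lookup S i then (f i - 1ℚ) ⊔ 0ℚ else f i

GreedyStep : (n p : ℕ) → Fills n → Fills n → Set
GreedyStep n p f g =
  Σ (Fin n → ℚ) λ a → ValidFill n p a ×
    Σ (Subset n) λ S → GreedyChoice n p (λ i → f i + a i) S ×
      ((i : Fin n) → g i ≡ empty (λ j → f j + a j) S i)

-- a play of the game (any filler, any greedy tie-breaking), starting empty
GreedyPlay : (n p : ℕ) → (ℕ → Fills n) → Set
GreedyPlay n p fills =
  ((i : Fin n) → fills 0 i ≡ 0ℚ) × ((t : ℕ) → GreedyStep n p (fills t) (fills (suc t)))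

{-# OPTIONS --safe #-}
-- Greedy maintains the invariant that every set T of cups holds at most capacity ∣T∣ in total,
-- where capacity k = k + weight 1 + ⋯ + weight k and
-- weight j = (2p + 1 ∸ j) + 2 (⌊log₂ n⌋ ∸ ⌊log₂ j⌋); so a single cup holds at most 1 + 2p + 2⌊log₂ n⌋.
-- Let S be the p cups emptied in a step. If some cup of S held less than one unit after filling,
-- so does every cup outside S, and the old bound for T ∩ S suffices. Otherwise every cup of S
-- loses exactly one unit. If S ⊆ T, these p units pay for the at most p units poured in. If some
-- d ∈ S lies outside T, use the bound for T ∪ {d}: every cup of T ─ S holds at most one unit more
-- than d, and averaging reduces the bound for T to
--   capacity a + c · capacity (a + c + 1) + c ≤ (c + 1) · capacity (a + c)
-- for a = ∣T ∩ S∣ < p and c = ∣T ─ S∣, i.e. to the weights on (a, a + c] exceeding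
-- weight (a + c + 1) by at least one on average.
module Submission where

open import Defs
open import Data.Nat.Base as ℕ using (ℕ; zero; suc)
open import Data.Nat.Logarithm using (⌊log₂_⌋)
open import Data.Fin.Base using (Fin; zero; suc)
open import Data.Fin.Subset
  using (Subset; inside; outside; _∈_; _∉_; _⊆_; _∩_; _∪_; _─_; ⁅_⁆; ⊥; ∣_∣; Empty)
open import Data.Fin.Subset.Properties using (∣⁅x⁆∣≡1)
open import Data.Product.Base using (Σ; _,_; proj₁; proj₂)
open import Data.Rational.Base as ℚ using (ℚ; 0ℚ; 1ℚ)
open import Data.Vec.Base using (_∷_; []; here; there)
open import Function.Base using (_∘_)
open import Relation.Binary.PropositionalEquality
open import Relation.Nullary using (yes; no; contradiction)

module NaturalArithmetic where

  open import Data.Nat.Base using (_+_; _*_; _∸_; _≤_; _<_; z≤n; s≤s; ⌈_/2⌉)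
  open import Data.Nat.Properties
  open import Data.Nat.Logarithm using (⌊log₂⌋-mono-≤; ⌊log₂[2*b]⌋≡1+⌊log₂b⌋)
  open import Data.Nat.Tactic.RingSolver using (solve-∀)
  open import Algebra.Properties.CommutativeSemigroup +-commutativeSemigroup
    using (x∙yz≈xz∙y; xy∙z≈xz∙y)

  +-assoc₄ : ∀ x y z w → x + (y + z + w) ≡ x + y + z + w
  +-assoc₄ = solve-∀

  three-ranges-count : ∀ p q r s v → 1 ≤ q → s ≤ p + r →
                       (q + r + s) * suc v ≤ q * (suc p + v) + r * (2 + v) + s * v
  three-ranges-count p q@(suc q′) r s v _ s≤p+r = begin
    (q + r + s) * suc v                    ≡⟨ *-suc (q + r + s) v ⟩
    q + r + s + (q + r + s) * v            ≤⟨ +-monoˡ-≤ ((q + r + s) * v) (+-monoʳ-≤ (q + r) s≤qp+r) ⟩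
    q + r + (q * p + r) + (q + r + s) * v  ≡⟨ regroup p q r s v ⟩
    q * (suc p + v) + r * (2 + v) + s * v  ∎
    where
    open ≤-Reasoning
    s≤qp+r : s ≤ q * p + r
    s≤qp+r = ≤-trans s≤p+r (+-monoˡ-≤ r (m≤m+n p (q′ * p)))
    regroup : ∀ p q r s v → q + r + (q * p + r) + (q + r + s) * v ≡ q * (suc p + v) + r * (2 + v) + s * v
    regroup = solve-∀

  module Capacity (n p : ℕ) where

    depth : ℕ → ℕ
    depth j = ⌊log₂ n ⌋ ∸ ⌊log₂ j ⌋

    weight : ℕ → ℕ
    weight j = (suc (p + p) ∸ j) + 2 * depth j

    total : ℕ → ℕ
    total zero    = 0
    total (suc k) = total k + weight (suc k)

    capacity : ℕ → ℕ
    capacity k = k + total k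

    depth-antitone : ∀ {j k} → j ≤ k → depth k ≤ depth j
    depth-antitone j≤k = ∸-monoʳ-≤ ⌊log₂ n ⌋ (⌊log₂⌋-mono-≤ j≤k)

    depth-halving : ∀ {j k} → 2 * suc j ≤ k → k ≤ n → suc (depth k) ≤ depth (suc j)
    depth-halving {j} {k} 2j≤k k≤n = ∸-monoʳ-< log[j]<log[k] (⌊log₂⌋-mono-≤ k≤n)
      where
      log[j]<log[k] : ⌊log₂ suc j ⌋ < ⌊log₂ k ⌋
      log[j]<log[k] = subst (_≤ ⌊log₂ k ⌋) (⌊log₂[2*b]⌋≡1+⌊log₂b⌋ (suc j)) (⌊log₂⌋-mono-≤ 2j≤k)

    2*depth≤weight : ∀ j → 2 * depth j ≤ weight j
    2*depth≤weight j = m≤n+m (2 * depth j) (suc (p + p) ∸ j)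

    total-range : ∀ {a b} c v → a + c ≡ b → (∀ j → a < j → j ≤ b → v ≤ weight j) →
                  total a + c * v ≤ total b
    total-range {a} zero    v refl _     =
      ≤-reflexive (trans (+-identityʳ (total a)) (cong total (sym (+-identityʳ a))))
    total-range {a} (suc c) v refl bound = begin
      total a + (v + c * v)                 ≡⟨ x∙yz≈xz∙y (total a) v (c * v) ⟩
      total a + c * v + v                   ≤⟨ +-mono-≤ (total-range c v refl below) last ⟩
      total (a + c) + weight (suc (a + c))  ≡⟨ cong total (+-suc a c) ⟨
      total (a + suc c)                     ∎
      where
      open ≤-Reasoning
      below : ∀ j → a < j → j ≤ a + c → v ≤ weight j
      below j a<j j≤a+c = bound j a<j (≤-trans j≤a+c (+-monoʳ-≤ a (n≤1+n c)))
      last : v ≤ weight (suc (a + c))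
      last = bound (suc (a + c)) (s≤s (m≤m+n a c)) (≤-reflexive (sym (+-suc a c)))

    capacity[k]+e≤capacity[k+e] : ∀ k e → capacity k + e ≤ capacity (k + e)
    capacity[k]+e≤capacity[k+e] k e = begin
      k + total k + e        ≡⟨ xy∙z≈xz∙y k (total k) e ⟩
      k + e + total k        ≤⟨ +-monoʳ-≤ (k + e) total[k]≤total[k+e] ⟩
      k + e + total (k + e)  ∎
      where
      open ≤-Reasoning
      total[k]≤total[k+e] : total k ≤ total (k + e)
      total[k]≤total[k+e] = subst (_≤ total (k + e)) (trans (cong (total k +_) (*-zeroʳ e)) (+-identityʳ _))
                                  (total-range {k} e 0 refl λ _ _ _ → z≤n)

    total-exceeds-next-near : ∀ a c → a + c ≤ p + p →
                              total a + c * suc (weight (suc (a + c))) ≤ total (a + c)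
    total-exceeds-next-near a c u≤2p = total-range c _ refl λ j _ j≤u →
      +-mono-≤ (∸-monoʳ-< (s≤s j≤u) (s≤s u≤2p)) (*-monoʳ-≤ 2 (depth-antitone (m≤n⇒m≤1+n j≤u)))

    -- Split (a, u] at p and w = ⌈u/2⌉: on the three pieces the weights exceed v = weight (u + 1)
    -- by at least p + 1 (the linear term), 2 (as 2j ≤ u + 1, ⌊log₂ j⌋ < ⌊log₂ (u + 1)⌋) and 0.
    total-exceeds-next-far : ∀ a c → a < p → suc (a + c) ≤ n → p + p < a + c →
                             total a + c * suc (weight (suc (a + c))) ≤ total (a + c)
    total-exceeds-next-far a c a<p u<n 2p<u = begin
      total a + c * suc (weight (suc u))
        ≡⟨ cong (λ x → total a + c * suc x) weight[u+1]≡v ⟩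
      total a + c * suc v
        ≡⟨ cong (λ x → total a + x * suc v) c≡q+r+s ⟩
      total a + (q + r + s) * suc v
        ≤⟨ +-monoʳ-≤ (total a) counted ⟩
      total a + (q * (suc p + v) + r * (2 + v) + s * v)
        ≡⟨ +-assoc₄ (total a) _ _ _ ⟩
      total a + q * (suc p + v) + r * (2 + v) + s * v
        ≤⟨ +-monoˡ-≤ (s * v) (+-monoˡ-≤ (r * (2 + v)) low) ⟩
      total p + r * (2 + v) + s * v
        ≤⟨ +-monoˡ-≤ (s * v) middle ⟩
      total w + s * v
        ≤⟨ high ⟩
      total u ∎
      where
      open ≤-Reasoning
      u = a + c
      v = 2 * depth (suc u)
      w = ⌈ u /2⌉
      q = p ∸ a
      r = w ∸ p
      s = u ∸ w
      weight[u+1]≡v : weight (suc u) ≡ v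
      weight[u+1]≡v = cong (_+ v) (m≤n⇒m∸n≡0 (m≤n⇒m≤1+n 2p<u))
      u≤2w : u ≤ w + w
      u≤2w = subst (_≤ w + w) (⌊n/2⌋+⌈n/2⌉≡n u) (+-monoˡ-≤ w (⌊n/2⌋≤⌈n/2⌉ u))
      2w≤u+1 : 2 * w ≤ suc u
      2w≤u+1 = begin
        2 * w                ≡⟨ cong (w +_) (+-identityʳ w) ⟩
        w + w                ≤⟨ +-monoʳ-≤ w (⌊n/2⌋≤⌈n/2⌉ (suc u)) ⟩
        w + ⌈ suc u /2⌉      ≡⟨ ⌊n/2⌋+⌈n/2⌉≡n (suc u) ⟩
        suc u                ∎
      p≤w : p ≤ w
      p≤w = ≮⇒≥ λ w<p → <-irrefl refl (≤-<-trans u≤2w (<-trans (+-mono-< w<p w<p) 2p<u))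
      p<u : p < u
      p<u = ≤-<-trans (m≤m+n p p) 2p<u
      a+q≡p : a + q ≡ p
      a+q≡p = m+[n∸m]≡n (<⇒≤ a<p)
      p+r≡w : p + r ≡ w
      p+r≡w = m+[n∸m]≡n p≤w
      w+s≡u : w + s ≡ u
      w+s≡u = m+[n∸m]≡n (⌈n/2⌉≤n u)
      c≡q+r+s : c ≡ q + r + s
      c≡q+r+s = +-cancelˡ-≡ a c (q + r + s) (sym (begin-equality
        a + (q + r + s)  ≡⟨ +-assoc₄ a q r s ⟩
        a + q + r + s    ≡⟨ cong (λ x → x + r + s) a+q≡p ⟩
        p + r + s        ≡⟨ cong (_+ s) p+r≡w ⟩
        w + s            ≡⟨ w+s≡u ⟩
        u                ∎))
      counted : (q + r + s) * suc v ≤ q * (suc p + v) + r * (2 + v) + s * v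
      counted = three-ranges-count p q r s v (m<n⇒0<n∸m a<p)
        (subst (s ≤_) (sym p+r≡w) (+-cancelˡ-≤ w s w (subst (_≤ w + w) (sym w+s≡u) u≤2w)))
      low : total a + q * (suc p + v) ≤ total p
      low = total-range q _ a+q≡p λ j _ j≤p →
        +-mono-≤ (≤-trans (≤-reflexive (sym (m+n∸n≡m (suc p) p))) (∸-monoʳ-≤ (suc (p + p)) j≤p))
                 (*-monoʳ-≤ 2 (depth-antitone (≤-trans j≤p (<⇒≤ (m<n⇒m<1+n p<u)))))
      middle : total p + r * (2 + v) ≤ total w
      middle = total-range r _ p+r≡w λ where
        (suc j) _ j≤w → begin
          2 + v                    ≡⟨ *-suc 2 (depth (suc u)) ⟨
          2 * suc (depth (suc u))  ≤⟨ *-monoʳ-≤ 2 (depth-halving (≤-trans (*-monoʳ-≤ 2 j≤w) 2w≤u+1) u<n) ⟩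
          2 * depth (suc j)        ≤⟨ 2*depth≤weight (suc j) ⟩
          weight (suc j)           ∎
      high : total w + s * v ≤ total u
      high = total-range s v w+s≡u λ j _ j≤u →
        ≤-trans (*-monoʳ-≤ 2 (depth-antitone (m≤n⇒m≤1+n j≤u))) (2*depth≤weight j)

    total-exceeds-next : ∀ a c → a < p → suc (a + c) ≤ n →
                         total a + c * suc (weight (suc (a + c))) ≤ total (a + c)
    total-exceeds-next a c a<p u<n with a + c ≤? p + p
    ... | yes u≤2p = total-exceeds-next-near a c u≤2p
    ... | no  u≰2p = total-exceeds-next-far a c a<p u<n (≰⇒> u≰2p)

    capacity-averaging : ∀ a c → a < p → suc (a + c) ≤ n →
                         capacity a + c * capacity (suc (a + c)) + c ≤ suc c * capacity (a + c)
    capacity-averaging a c a<p u<n = begin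
      capacity a + c * capacity (suc (a + c)) + c
        ≡⟨ regroup a c (total a) (total (a + c)) (weight (suc (a + c))) ⟩
      a + c + c * capacity (a + c) + (total a + c * suc (weight (suc (a + c))))
        ≤⟨ +-monoʳ-≤ (a + c + c * capacity (a + c)) (total-exceeds-next a c a<p u<n) ⟩
      a + c + c * capacity (a + c) + total (a + c)
        ≡⟨ collect (a + c) c (total (a + c)) ⟩
      suc c * capacity (a + c) ∎
      where
      open ≤-Reasoning
      regroup : ∀ a c A U g →
                a + A + c * (suc (a + c) + (U + g)) + c ≡ a + c + c * (a + c + U) + (A + c * suc g)
      regroup = solve-∀
      collect : ∀ u c U → u + c * (u + U) + U ≡ suc c * (u + U)
      collect = solve-∀

    capacity-one : 1 ≤ p → capacity 1 ≤ 3 * (p + ⌊log₂ n ⌋)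
    capacity-one 1≤p = begin
      suc (p + p + 2 * L)      ≡⟨ +-comm 1 (p + p + 2 * L) ⟩
      p + p + 2 * L + 1        ≤⟨ +-monoʳ-≤ (p + p + 2 * L) (≤-trans 1≤p (m≤m+n p L)) ⟩
      p + p + 2 * L + (p + L)  ≡⟨ collect p L ⟩
      3 * (p + L)              ∎
      where
      open ≤-Reasoning
      L = ⌊log₂ n ⌋
      collect : ∀ p L → p + p + 2 * L + (p + L) ≡ 3 * (p + L)
      collect = solve-∀

module RationalArithmetic where

  open import Data.Nat.Coprimality as Coprime using (1-coprimeTo)
  import Data.Integer.Base as ℤ
  import Data.Integer.Properties as ℤ
  open import Data.Rational.Base
    using (mkℚ; _/_; _+_; _*_; _-_; -_; _≤_; _⊔_; *≤*; NonNegative; Positive)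
  open import Data.Rational.Properties
  open import Data.Rational.Solver using (module +-*-Solver)
  open import Algebra.Properties.Group +-0-group using (//-rightDividesˡ; //-rightDividesʳ)

  ℕtoℚ≡mkℚ : ∀ k → ℕtoℚ k ≡ mkℚ (ℤ.+ k) 0 (Coprime.sym (1-coprimeTo k))
  ℕtoℚ≡mkℚ k = normalize-coprime (Coprime.sym (1-coprimeTo k))

  ℕtoℚ-+ : ∀ m k → ℕtoℚ (m ℕ.+ k) ≡ ℕtoℚ m + ℕtoℚ k
  ℕtoℚ-+ m k rewrite ℕtoℚ≡mkℚ m | ℕtoℚ≡mkℚ k =
    cong (_/ 1) (sym (cong₂ ℤ._+_ (ℤ.*-identityʳ (ℤ.+ m)) (ℤ.*-identityʳ (ℤ.+ k))))

  ℕtoℚ-suc : ∀ k → ℕtoℚ (suc k) ≡ 1ℚ + ℕtoℚ k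
  ℕtoℚ-suc = ℕtoℚ-+ 1

  ℕtoℚ-* : ∀ m k → ℕtoℚ (m ℕ.* k) ≡ ℕtoℚ m * ℕtoℚ k
  ℕtoℚ-* m k rewrite ℕtoℚ≡mkℚ m | ℕtoℚ≡mkℚ k = cong (_/ 1) (ℤ.pos-* m k)

  ℕtoℚ-mono-≤ : ∀ {m k} → m ℕ.≤ k → ℕtoℚ m ≤ ℕtoℚ k
  ℕtoℚ-mono-≤ {m} {k} m≤k rewrite ℕtoℚ≡mkℚ m | ℕtoℚ≡mkℚ k =
    *≤* (subst₂ ℤ._≤_ (sym (ℤ.*-identityʳ _)) (sym (ℤ.*-identityʳ _)) (ℤ.+≤+ m≤k))

  ℕtoℚ-nonNeg : ∀ k → NonNegative (ℕtoℚ k)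
  ℕtoℚ-nonNeg k = subst NonNegative (sym (ℕtoℚ≡mkℚ k)) _

  ℕtoℚ-pos : ∀ k → Positive (ℕtoℚ (suc k))
  ℕtoℚ-pos k = subst Positive (sym (ℕtoℚ≡mkℚ (suc k))) _

  +-cancelʳ-≤ : ∀ {x y} r → x + r ≤ y + r → x ≤ y
  +-cancelʳ-≤ {x} {y} r x+r≤y+r =
    subst₂ _≤_ (//-rightDividesʳ r x) (//-rightDividesʳ r y) (+-monoˡ-≤ (- r) x+r≤y+r)

  averaging : ∀ {α σ ζ : ℚ} {A B₊ B c : ℕ} →
              α ≤ ℕtoℚ A → σ ≤ ℕtoℚ c * (ζ + 1ℚ) → α + σ + ζ ≤ ℕtoℚ B₊ →
              A ℕ.+ c ℕ.* B₊ ℕ.+ c ℕ.≤ suc c ℕ.* B → α + σ ≤ ℕtoℚ B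
  averaging {α} {σ} {ζ} {A} {B₊} {B} {c} α≤A σ≤c[ζ+1] α+σ+ζ≤B₊ A+cB₊+c≤[1+c]B =
    *-cancelˡ-≤-pos (ℕtoℚ (suc c)) {{ℕtoℚ-pos c}} (begin
      ℕtoℚ (suc c) * (α + σ)             ≡⟨ cong (_* (α + σ)) (ℕtoℚ-suc c) ⟩
      (1ℚ + C) * (α + σ)                 ≡⟨ expand C α σ ⟩
      α + (σ + C * (α + σ))              ≤⟨ +-monoʳ-≤ α (+-monoˡ-≤ (C * (α + σ)) σ≤c[ζ+1]) ⟩
      α + (C * (ζ + 1ℚ) + C * (α + σ))   ≡⟨ collect C α σ ζ ⟩
      α + C * (α + σ + ζ) + C            ≤⟨ +-monoˡ-≤ C (+-mono-≤ α≤A C[α+σ+ζ]≤CB₊) ⟩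
      ℕtoℚ A + C * ℕtoℚ B₊ + C           ≡⟨ cong (λ x → ℕtoℚ A + x + C) (ℕtoℚ-* c B₊) ⟨
      ℕtoℚ A + ℕtoℚ (c ℕ.* B₊) + C       ≡⟨ cong (_+ C) (ℕtoℚ-+ A (c ℕ.* B₊)) ⟨
      ℕtoℚ (A ℕ.+ c ℕ.* B₊) + C          ≡⟨ ℕtoℚ-+ (A ℕ.+ c ℕ.* B₊) c ⟨
      ℕtoℚ (A ℕ.+ c ℕ.* B₊ ℕ.+ c)        ≤⟨ ℕtoℚ-mono-≤ A+cB₊+c≤[1+c]B ⟩
      ℕtoℚ (suc c ℕ.* B)                 ≡⟨ ℕtoℚ-* (suc c) B ⟩
      ℕtoℚ (suc c) * ℕtoℚ B              ∎)
    where
    open ≤-Reasoning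
    open +-*-Solver
    C = ℕtoℚ c
    C[α+σ+ζ]≤CB₊ : C * (α + σ + ζ) ≤ C * ℕtoℚ B₊
    C[α+σ+ζ]≤CB₊ = *-monoˡ-≤-nonNeg C {{ℕtoℚ-nonNeg c}} α+σ+ζ≤B₊
    expand : ∀ C α σ → (1ℚ + C) * (α + σ) ≡ α + (σ + C * (α + σ))
    expand = solve 3 (λ C α σ → (con 1ℚ :+ C) :* (α :+ σ) := α :+ (σ :+ C :* (α :+ σ))) refl
    collect : ∀ C α σ ζ → α + (C * (ζ + 1ℚ) + C * (α + σ)) ≡ α + C * (α + σ + ζ) + C
    collect = solve 4 (λ C α σ ζ → α :+ (C :* (ζ :+ con 1ℚ) :+ C :* (α :+ σ))
                                := α :+ C :* (α :+ σ :+ ζ) :+ C) refl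

  truncated-decrement-nonneg : ∀ q → 0ℚ ≤ (q - 1ℚ) ⊔ 0ℚ
  truncated-decrement-nonneg q = p≤q⊔p (q - 1ℚ) 0ℚ

  truncated-decrement-+1 : ∀ q → q ≤ (q - 1ℚ) ⊔ 0ℚ + 1ℚ
  truncated-decrement-+1 q =
    subst (_≤ (q - 1ℚ) ⊔ 0ℚ + 1ℚ) (//-rightDividesˡ 1ℚ q) (+-monoˡ-≤ 1ℚ (p≤p⊔q (q - 1ℚ) 0ℚ))

  truncated-decrement-exact : ∀ {q} → 1ℚ ≤ q → (q - 1ℚ) ⊔ 0ℚ + 1ℚ ≡ q
  truncated-decrement-exact {q} 1≤q = trans (cong (_+ 1ℚ) (p≥q⇒p⊔q≡p 0≤q-1)) (//-rightDividesˡ 1ℚ q)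
    where
    0≤q-1 : 0ℚ ≤ q - 1ℚ
    0≤q-1 = subst (_≤ q - 1ℚ) (+-inverseʳ 1ℚ) (+-monoˡ-≤ (- 1ℚ) 1≤q)

  truncated-decrement-≤ : ∀ {x a} → 0ℚ ≤ x → a ≤ 1ℚ → (x + a - 1ℚ) ⊔ 0ℚ ≤ x
  truncated-decrement-≤ {x} 0≤x a≤1 =
    ⊔-lub (subst (x + _ - 1ℚ ≤_) (//-rightDividesʳ 1ℚ x) (+-monoˡ-≤ (- 1ℚ) (+-monoʳ-≤ x a≤1))) 0≤x

module SubsetSums where

  import Data.Nat.Properties as ℕ
  open import Data.Fin.Subset.Properties using (∪-identityʳ; _∈?_; x∈p∧x∉q⇒x∈p─q)
  open import Data.Rational.Base using (_+_; _*_; _≤_)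
  open import Data.Rational.Properties
  open import Algebra.Bundles using (CommutativeMonoid)
  open import Algebra.Properties.CommutativeSemigroup
    (CommutativeMonoid.commutativeSemigroup +-0-commutativeMonoid) using (interchange; x∙yz≈y∙xz)
  open RationalArithmetic using (ℕtoℚ-suc)

  private
    variable
      n : ℕ

  sumIn : Subset n → (Fin n → ℚ) → ℚ
  sumIn []            f = 0ℚ
  sumIn (inside  ∷ T) f = f zero + sumIn T (f ∘ suc)
  sumIn (outside ∷ T) f = sumIn T (f ∘ suc)

  sumIn-mono : ∀ (T : Subset n) {f g} → (∀ {i} → i ∈ T → f i ≤ g i) → sumIn T f ≤ sumIn T g
  sumIn-mono []            f≤g = ≤-refl
  sumIn-mono (inside  ∷ T) f≤g = +-mono-≤ (f≤g here) (sumIn-mono T (f≤g ∘ there))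
  sumIn-mono (outside ∷ T) f≤g = sumIn-mono T (f≤g ∘ there)

  sumIn-cong : ∀ (T : Subset n) {f g} → (∀ {i} → i ∈ T → f i ≡ g i) → sumIn T f ≡ sumIn T g
  sumIn-cong T f≡g =
    ≤-antisym (sumIn-mono T (≤-reflexive ∘ f≡g)) (sumIn-mono T (≤-reflexive ∘ sym ∘ f≡g))

  sumIn-+ : ∀ (T : Subset n) f g → sumIn T (λ i → f i + g i) ≡ sumIn T f + sumIn T g
  sumIn-+ []            f g = refl
  sumIn-+ (inside  ∷ T) f g = trans (cong (f zero + g zero +_) (sumIn-+ T (f ∘ suc) (g ∘ suc)))
                                    (interchange (f zero) (g zero) _ _)
  sumIn-+ (outside ∷ T) f g = sumIn-+ T (f ∘ suc) (g ∘ suc)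

  sumIn-const : ∀ (T : Subset n) q → sumIn T (λ _ → q) ≡ ℕtoℚ ∣ T ∣ * q
  sumIn-const []            q = sym (*-zeroˡ q)
  sumIn-const (inside  ∷ T) q = begin
    q + sumIn T (λ _ → q)     ≡⟨ cong (q +_) (sumIn-const T q) ⟩
    q + ℕtoℚ ∣ T ∣ * q        ≡⟨ cong (_+ ℕtoℚ ∣ T ∣ * q) (*-identityˡ q) ⟨
    1ℚ * q + ℕtoℚ ∣ T ∣ * q   ≡⟨ *-distribʳ-+ q 1ℚ (ℕtoℚ ∣ T ∣) ⟨
    (1ℚ + ℕtoℚ ∣ T ∣) * q     ≡⟨ cong (_* q) (ℕtoℚ-suc ∣ T ∣) ⟨
    ℕtoℚ (suc ∣ T ∣) * q      ∎
    where open ≡-Reasoning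
  sumIn-const (outside ∷ T) q = sumIn-const T q

  sumIn-1 : ∀ (T : Subset n) → sumIn T (λ _ → 1ℚ) ≡ ℕtoℚ ∣ T ∣
  sumIn-1 T = trans (sumIn-const T 1ℚ) (*-identityʳ (ℕtoℚ ∣ T ∣))

  sumIn-+1 : ∀ (T : Subset n) f → sumIn T (λ i → f i + 1ℚ) ≡ sumIn T f + ℕtoℚ ∣ T ∣
  sumIn-+1 T f = trans (sumIn-+ T f (λ _ → 1ℚ)) (cong (sumIn T f +_) (sumIn-1 T))

  sumIn-split : ∀ (T S : Subset n) f → sumIn T f ≡ sumIn (T ∩ S) f + sumIn (T ─ S) f
  sumIn-split []            []            f = sym (+-identityʳ 0ℚ)
  sumIn-split (inside  ∷ T) (inside  ∷ S) f =
    trans (cong (f zero +_) (sumIn-split T S (f ∘ suc))) (sym (+-assoc (f zero) _ _))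
  sumIn-split (inside  ∷ T) (outside ∷ S) f =
    trans (cong (f zero +_) (sumIn-split T S (f ∘ suc)))
          (x∙yz≈y∙xz (f zero) (sumIn (T ∩ S) (f ∘ suc)) (sumIn (T ─ S) (f ∘ suc)))
  sumIn-split (outside ∷ T) (inside  ∷ S) f = sumIn-split T S (f ∘ suc)
  sumIn-split (outside ∷ T) (outside ∷ S) f = sumIn-split T S (f ∘ suc)

  ∣p∣≡∣p∩q∣+∣p─q∣ : ∀ (p q : Subset n) → ∣ p ∣ ≡ ∣ p ∩ q ∣ ℕ.+ ∣ p ─ q ∣
  ∣p∣≡∣p∩q∣+∣p─q∣ []            []            = refl
  ∣p∣≡∣p∩q∣+∣p─q∣ (inside  ∷ p) (inside  ∷ q) = cong suc (∣p∣≡∣p∩q∣+∣p─q∣ p q)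
  ∣p∣≡∣p∩q∣+∣p─q∣ (inside  ∷ p) (outside ∷ q) =
    trans (cong suc (∣p∣≡∣p∩q∣+∣p─q∣ p q)) (sym (ℕ.+-suc _ _))
  ∣p∣≡∣p∩q∣+∣p─q∣ (outside ∷ p) (inside  ∷ q) = ∣p∣≡∣p∩q∣+∣p─q∣ p q
  ∣p∣≡∣p∩q∣+∣p─q∣ (outside ∷ p) (outside ∷ q) = ∣p∣≡∣p∩q∣+∣p─q∣ p q

  sumIn-∪⁅⁆ : ∀ {x : Fin n} (T : Subset n) f → x ∉ T → sumIn (T ∪ ⁅ x ⁆) f ≡ sumIn T f + f x
  sumIn-∪⁅⁆ {x = zero}  (inside  ∷ T) f x∉T = contradiction here x∉T
  sumIn-∪⁅⁆ {x = zero}  (outside ∷ T) f x∉T =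
    trans (cong (λ U → f zero + sumIn U (f ∘ suc)) (∪-identityʳ T)) (+-comm (f zero) _)
  sumIn-∪⁅⁆ {x = suc x} (inside  ∷ T) f x∉T =
    trans (cong (f zero +_) (sumIn-∪⁅⁆ T (f ∘ suc) (x∉T ∘ there))) (sym (+-assoc (f zero) _ _))
  sumIn-∪⁅⁆ {x = suc x} (outside ∷ T) f x∉T = sumIn-∪⁅⁆ T (f ∘ suc) (x∉T ∘ there)

  x∉p⇒∣p∪⁅x⁆∣≡1+∣p∣ : ∀ {x : Fin n} (p : Subset n) → x ∉ p → ∣ p ∪ ⁅ x ⁆ ∣ ≡ suc ∣ p ∣
  x∉p⇒∣p∪⁅x⁆∣≡1+∣p∣ {x = zero}  (inside  ∷ p) x∉p = contradiction here x∉p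
  x∉p⇒∣p∪⁅x⁆∣≡1+∣p∣ {x = zero}  (outside ∷ p) x∉p = cong (suc ∘ ∣_∣) (∪-identityʳ p)
  x∉p⇒∣p∪⁅x⁆∣≡1+∣p∣ {x = suc x} (inside  ∷ p) x∉p =
    cong suc (x∉p⇒∣p∪⁅x⁆∣≡1+∣p∣ p (x∉p ∘ there))
  x∉p⇒∣p∪⁅x⁆∣≡1+∣p∣ {x = suc x} (outside ∷ p) x∉p = x∉p⇒∣p∪⁅x⁆∣≡1+∣p∣ p (x∉p ∘ there)

  sumIn-⊥ : ∀ f → sumIn {n} ⊥ f ≡ 0ℚ
  sumIn-⊥ {zero}  f = refl
  sumIn-⊥ {suc n} f = sumIn-⊥ (f ∘ suc)

  sumIn-⁅⁆ : ∀ (x : Fin n) f → sumIn ⁅ x ⁆ f ≡ f x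
  sumIn-⁅⁆ zero    f = trans (cong (f zero +_) (sumIn-⊥ (f ∘ suc))) (+-identityʳ (f zero))
  sumIn-⁅⁆ (suc x) f = sumIn-⁅⁆ x (f ∘ suc)

  sumIn≤sumFin : ∀ (T : Subset n) {f} → (∀ i → 0ℚ ≤ f i) → sumIn T f ≤ sumFin f
  sumIn≤sumFin []                f≥0 = ≤-refl
  sumIn≤sumFin (inside  ∷ T) {f} f≥0 = +-monoʳ-≤ (f zero) (sumIn≤sumFin T (f≥0 ∘ suc))
  sumIn≤sumFin (outside ∷ T) {f} f≥0 = begin
    sumIn T (f ∘ suc)          ≤⟨ sumIn≤sumFin T (f≥0 ∘ suc) ⟩
    sumFin (f ∘ suc)           ≡⟨ +-identityˡ (sumFin (f ∘ suc)) ⟨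
    0ℚ + sumFin (f ∘ suc)      ≤⟨ +-monoˡ-≤ (sumFin (f ∘ suc)) (f≥0 zero) ⟩
    f zero + sumFin (f ∘ suc)  ∎
    where open ≤-Reasoning

  x∈p─q⇒x∉q : ∀ {x : Fin n} (p q : Subset n) → x ∈ p ─ q → x ∉ q
  x∈p─q⇒x∉q (_ ∷ p) (outside ∷ q) here          ()
  x∈p─q⇒x∉q (_ ∷ p) (_       ∷ q) (there x∈p─q) (there x∈q) = x∈p─q⇒x∉q p q x∈p─q x∈q

  Empty[p─q]⇒p⊆q : ∀ {p q : Subset n} → Empty (p ─ q) → p ⊆ q
  Empty[p─q]⇒p⊆q {q = q} empty {x} x∈p with x ∈? q
  ... | yes x∈q = x∈q
  ... | no  x∉q = contradiction (x , x∈p∧x∉q⇒x∈p─q x∈p x∉q) empty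

module GreedyInvariant where

  open import Data.Nat.Induction using (<-wellFounded)
  open import Data.Fin.Properties using (any?)
  open import Data.Fin.Subset.Properties
    using (_∈?_; nonempty?; x∈p∩q⁺; x∈p∩q⁻; p∩q⊆q; p─q⊆p; p─q─r≡p─q∪r;
           x∈p⇒∣p-x∣<∣p∣; p⊂q⇒∣p∣<∣q∣; p⊆q⇒∣p∣≤∣q∣; ∣p∣≤n)
  open import Data.Vec.Base using (lookup)
  open import Data.Vec.Properties using (lookup⇒[]=; []=⇒lookup)
  open import Data.Rational.Base using (_+_; _*_; _-_; _≤_; _<_; _⊔_)
  open import Data.Rational.Properties
  open import Algebra.Bundles using (CommutativeMonoid)
  open import Algebra.Properties.CommutativeSemigroup
    (CommutativeMonoid.commutativeSemigroup +-0-commutativeMonoid) using (xy∙z≈xz∙y)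
  open import Induction.WellFounded using (Acc; acc)
  open import Relation.Nullary.Decidable using (_×-dec_)
  open NaturalArithmetic using (module Capacity)
  open RationalArithmetic
  open SubsetSums

  empty-∈ : ∀ {n} (f : Fills n) {S i} → i ∈ S → empty f S i ≡ (f i - 1ℚ) ⊔ 0ℚ
  empty-∈ f i∈S rewrite []=⇒lookup i∈S = refl

  empty-∉ : ∀ {n} (f : Fills n) {S i} → i ∉ S → empty f S i ≡ f i
  empty-∉ f {S} {i} i∉S with lookup S i in eq
  ... | inside  = contradiction (lookup⇒[]= i S eq) i∉S
  ... | outside = refl

  module Greedy (n p : ℕ) where

    open Capacity n p

    record Admissible (x : Fills n) : Set where
      field
        nonneg  : ∀ i → 0ℚ ≤ x i
        bounded : ∀ T → sumIn T x ≤ ℕtoℚ (capacity ∣ T ∣)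

    admissible-cong : ∀ {x x′ : Fills n} → (∀ i → x i ≡ x′ i) → Admissible x → Admissible x′
    admissible-cong x≗x′ adm = record
      { nonneg  = λ i → subst (0ℚ ≤_) (x≗x′ i) (nonneg i)
      ; bounded = λ T → subst (_≤ _) (sumIn-cong T (λ {i} _ → x≗x′ i)) (bounded T)
      }
      where open Admissible adm

    admissible-0 : Admissible (λ _ → 0ℚ)
    admissible-0 = record
      { nonneg  = λ _ → ≤-refl
      ; bounded = λ T → begin
          sumIn T (λ _ → 0ℚ)     ≡⟨ sumIn-const T 0ℚ ⟩
          ℕtoℚ ∣ T ∣ * 0ℚ        ≡⟨ *-zeroʳ (ℕtoℚ ∣ T ∣) ⟩
          0ℚ                     ≤⟨ nonNegative⁻¹ _ {{ℕtoℚ-nonNeg (capacity ∣ T ∣)}} ⟩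
          ℕtoℚ (capacity ∣ T ∣)  ∎
      }
      where open ≤-Reasoning

    module Step {x : Fills n} (adm : Admissible x) {a : Fin n → ℚ} (valid : ValidFill n p a)
                {S : Subset n} (greedy : GreedyChoice n p (λ i → x i + a i) S) where

      open Admissible adm

      y : Fills n
      y i = x i + a i

      z : Fills n
      z = empty y S

      ∣S∣≡p : ∣ S ∣ ≡ p
      ∣S∣≡p = proj₁ greedy

      z-nonneg : ∀ i → 0ℚ ≤ z i
      z-nonneg i with i ∈? S
      ... | yes i∈S = subst (0ℚ ≤_) (sym (empty-∈ y i∈S)) (truncated-decrement-nonneg (y i))
      ... | no  i∉S = subst (0ℚ ≤_) (sym (empty-∉ y i∉S)) (+-mono-≤ (nonneg i) (proj₁ (proj₁ valid i)))

      chosen-≤ : ∀ {i} → i ∈ S → z i ≤ x i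
      chosen-≤ {i} i∈S = subst (_≤ x i) (sym (empty-∈ y i∈S))
                               (truncated-decrement-≤ (nonneg i) (proj₂ (proj₁ valid i)))

      chosen-+1 : ∀ {i} → i ∈ S → y i ≤ z i + 1ℚ
      chosen-+1 {i} i∈S = subst (λ w → y i ≤ w + 1ℚ) (sym (empty-∈ y i∈S)) (truncated-decrement-+1 (y i))

      unchosen-≡ : ∀ {i} → i ∉ S → z i ≡ y i
      unchosen-≡ = empty-∉ y

      unchosen-≤-chosen : ∀ {i j} → j ∈ S → i ∉ S → y i ≤ y j
      unchosen-≤-chosen {i} {j} = proj₂ greedy j i

      ∈T∩S⇒∈S : ∀ T {i} → i ∈ T ∩ S → i ∈ S
      ∈T∩S⇒∈S T = proj₂ ∘ x∈p∩q⁻ T S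

      ∈T─S⇒∉S : ∀ T {i} → i ∈ T ─ S → i ∉ S
      ∈T─S⇒∉S T = x∈p─q⇒x∉q T S

      bound-chosen : ∀ T → sumIn (T ∩ S) z ≤ ℕtoℚ (capacity ∣ T ∩ S ∣)
      bound-chosen T = ≤-trans (sumIn-mono (T ∩ S) (chosen-≤ ∘ ∈T∩S⇒∈S T)) (bounded (T ∩ S))

      poured : ∀ T → sumIn T a ≤ ℕtoℚ p
      poured T = ≤-trans (sumIn≤sumFin T (proj₁ ∘ proj₁ valid)) (proj₂ valid)

      bound-underfull : ∀ {d} → d ∈ S → y d < 1ℚ → ∀ T → sumIn T z ≤ ℕtoℚ (capacity ∣ T ∣)
      bound-underfull {d} d∈S yd<1 T = begin
        sumIn T z                          ≡⟨ sumIn-split T S z ⟩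
        sumIn (T ∩ S) z + sumIn (T ─ S) z  ≤⟨ +-mono-≤ (bound-chosen T) bound-unchosen ⟩
        ℕtoℚ (capacity b) + ℕtoℚ c         ≡⟨ ℕtoℚ-+ (capacity b) c ⟨
        ℕtoℚ (capacity b ℕ.+ c)            ≤⟨ ℕtoℚ-mono-≤ (capacity[k]+e≤capacity[k+e] b c) ⟩
        ℕtoℚ (capacity (b ℕ.+ c))          ≡⟨ cong (ℕtoℚ ∘ capacity) (∣p∣≡∣p∩q∣+∣p─q∣ T S) ⟨
        ℕtoℚ (capacity ∣ T ∣)              ∎
        where
        open ≤-Reasoning
        b = ∣ T ∩ S ∣
        c = ∣ T ─ S ∣
        unchosen-≤-1 : ∀ {i} → i ∉ S → z i ≤ 1ℚ
        unchosen-≤-1 i∉S =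
          ≤-trans (≤-reflexive (unchosen-≡ i∉S)) (<⇒≤ (≤-<-trans (unchosen-≤-chosen d∈S i∉S) yd<1))
        bound-unchosen : sumIn (T ─ S) z ≤ ℕtoℚ c
        bound-unchosen =
          ≤-trans (sumIn-mono (T ─ S) (unchosen-≤-1 ∘ ∈T─S⇒∉S T)) (≤-reflexive (sumIn-1 (T ─ S)))

      module Saturated (saturated : ∀ {i} → i ∈ S → 1ℚ ≤ y i) where

        removed : ∀ T → sumIn T z + ℕtoℚ ∣ T ∩ S ∣ ≡ sumIn T y
        removed T = begin
          sumIn T z + ℕtoℚ b                   ≡⟨ cong (_+ ℕtoℚ b) (sumIn-split T S z) ⟩
          sumIn (T ∩ S) z + sumIn (T ─ S) z + ℕtoℚ b
                                               ≡⟨ xy∙z≈xz∙y (sumIn (T ∩ S) z) (sumIn (T ─ S) z) (ℕtoℚ b) ⟩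
          sumIn (T ∩ S) z + ℕtoℚ b + sumIn (T ─ S) z
                                               ≡⟨ cong₂ _+_ chosen unchosen ⟩
          sumIn (T ∩ S) y + sumIn (T ─ S) y    ≡⟨ sumIn-split T S y ⟨
          sumIn T y                            ∎
          where
          open ≡-Reasoning
          b = ∣ T ∩ S ∣
          chosen-exact : ∀ {i} → i ∈ S → z i + 1ℚ ≡ y i
          chosen-exact i∈S = trans (cong (_+ 1ℚ) (empty-∈ y i∈S)) (truncated-decrement-exact (saturated i∈S))
          chosen : sumIn (T ∩ S) z + ℕtoℚ b ≡ sumIn (T ∩ S) y
          chosen = trans (sym (sumIn-+1 (T ∩ S) z)) (sumIn-cong (T ∩ S) (chosen-exact ∘ ∈T∩S⇒∈S T))
          unchosen : sumIn (T ─ S) z ≡ sumIn (T ─ S) y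
          unchosen = sumIn-cong (T ─ S) (unchosen-≡ ∘ ∈T─S⇒∉S T)

        bound-covering : ∀ T → S ⊆ T → sumIn T z ≤ ℕtoℚ (capacity ∣ T ∣)
        bound-covering T S⊆T = +-cancelʳ-≤ (ℕtoℚ ∣ T ∩ S ∣) (begin
          sumIn T z + ℕtoℚ ∣ T ∩ S ∣              ≡⟨ removed T ⟩
          sumIn T y                               ≡⟨ sumIn-+ T x a ⟩
          sumIn T x + sumIn T a                   ≤⟨ +-mono-≤ (bounded T) (poured T) ⟩
          ℕtoℚ (capacity ∣ T ∣) + ℕtoℚ p          ≤⟨ +-monoʳ-≤ (ℕtoℚ (capacity ∣ T ∣)) (ℕtoℚ-mono-≤ p≤∣T∩S∣) ⟩
          ℕtoℚ (capacity ∣ T ∣) + ℕtoℚ ∣ T ∩ S ∣  ∎)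
          where
          open ≤-Reasoning
          p≤∣T∩S∣ : p ℕ.≤ ∣ T ∩ S ∣
          p≤∣T∩S∣ = subst (ℕ._≤ ∣ T ∩ S ∣) ∣S∣≡p (p⊆q⇒∣p∣≤∣q∣ λ i∈S → x∈p∩q⁺ (S⊆T i∈S , i∈S))

        bound-extend : ∀ {d} T → d ∈ S → d ∉ T →
                       sumIn (T ∪ ⁅ d ⁆) z ≤ ℕtoℚ (capacity ∣ T ∪ ⁅ d ⁆ ∣) →
                       sumIn T z ≤ ℕtoℚ (capacity ∣ T ∣)
        bound-extend {d} T d∈S d∉T extended =
          subst₂ (λ w k → w ≤ ℕtoℚ (capacity k)) (sym (sumIn-split T S z)) (sym (∣p∣≡∣p∩q∣+∣p─q∣ T S))
            (averaging {A = capacity b} {B₊ = capacity (suc (b ℕ.+ c))} {B = capacity (b ℕ.+ c)} {c = c}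
                       (bound-chosen T) bound-unchosen with-d (capacity-averaging b c b<p 1+b+c≤n))
          where
          b = ∣ T ∩ S ∣
          c = ∣ T ─ S ∣
          ∣T∪⁅d⁆∣≡1+b+c : ∣ T ∪ ⁅ d ⁆ ∣ ≡ suc (b ℕ.+ c)
          ∣T∪⁅d⁆∣≡1+b+c = trans (x∉p⇒∣p∪⁅x⁆∣≡1+∣p∣ T d∉T) (cong suc (∣p∣≡∣p∩q∣+∣p─q∣ T S))
          b<p : b ℕ.< p
          b<p = subst (b ℕ.<_) ∣S∣≡p (p⊂q⇒∣p∣<∣q∣ (p∩q⊆q T S , d , d∈S , d∉T ∘ proj₁ ∘ x∈p∩q⁻ T S))
          1+b+c≤n : suc (b ℕ.+ c) ℕ.≤ n
          1+b+c≤n = subst (ℕ._≤ n) ∣T∪⁅d⁆∣≡1+b+c (∣p∣≤n (T ∪ ⁅ d ⁆))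
          unchosen-≤-zd+1 : ∀ {i} → i ∉ S → z i ≤ z d + 1ℚ
          unchosen-≤-zd+1 i∉S =
            ≤-trans (≤-reflexive (unchosen-≡ i∉S)) (≤-trans (unchosen-≤-chosen d∈S i∉S) (chosen-+1 d∈S))
          bound-unchosen : sumIn (T ─ S) z ≤ ℕtoℚ c * (z d + 1ℚ)
          bound-unchosen = ≤-trans (sumIn-mono (T ─ S) (unchosen-≤-zd+1 ∘ ∈T─S⇒∉S T))
                                   (≤-reflexive (sumIn-const (T ─ S) (z d + 1ℚ)))
          with-d : sumIn (T ∩ S) z + sumIn (T ─ S) z + z d ≤ ℕtoℚ (capacity (suc (b ℕ.+ c)))
          with-d = subst₂ (λ w k → w ≤ ℕtoℚ (capacity k))
                          (trans (sumIn-∪⁅⁆ T z d∉T) (cong (_+ z d) (sumIn-split T S z)))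
                          ∣T∪⁅d⁆∣≡1+b+c extended

        bound-saturated : ∀ T → Acc ℕ._<_ ∣ S ─ T ∣ → sumIn T z ≤ ℕtoℚ (capacity ∣ T ∣)
        bound-saturated T (acc smaller) with nonempty? (S ─ T)
        ... | no  S─T-empty   = bound-covering T (Empty[p─q]⇒p⊆q S─T-empty)
        ... | yes (d , d∈S─T) = bound-extend T (p─q⊆p S T d∈S─T) (x∈p─q⇒x∉q S T d∈S─T)
                                  (bound-saturated (T ∪ ⁅ d ⁆) (smaller shrinks))
          where
          shrinks : ∣ S ─ (T ∪ ⁅ d ⁆) ∣ ℕ.< ∣ S ─ T ∣
          shrinks = subst (ℕ._< ∣ S ─ T ∣) (cong ∣_∣ (p─q─r≡p─q∪r S T ⁅ d ⁆))
                          (x∈p⇒∣p-x∣<∣p∣ d∈S─T)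

      admissible : Admissible z
      admissible = record { nonneg = z-nonneg ; bounded = bound }
        where
        bound : ∀ T → sumIn T z ≤ ℕtoℚ (capacity ∣ T ∣)
        bound T with any? (λ d → (d ∈? S) ×-dec (y d <? 1ℚ))
        ... | yes (d , d∈S , yd<1) = bound-underfull d∈S yd<1 T
        ... | no  none             = Saturated.bound-saturated saturated T (<-wellFounded _)
          where
          saturated : ∀ {d} → d ∈ S → 1ℚ ≤ y d
          saturated d∈S = ≮⇒≥ λ yd<1 → none (_ , d∈S , yd<1)

    step-admissible : ∀ {x x′} → Admissible x → GreedyStep n p x x′ → Admissible x′
    step-admissible adm (a , valid , S , greedy , x′≡z) =
      admissible-cong (sym ∘ x′≡z) (Step.admissible adm valid greedy)

    play-admissible : ∀ fills → GreedyPlay n p fills → ∀ t → Admissible (fills t)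
    play-admissible fills (start , _)    zero    = admissible-cong (sym ∘ start) admissible-0
    play-admissible fills (start , step) (suc t) =
      step-admissible (play-admissible fills (start , step) t) (step t)

open import Data.Nat.Base using (_≤_; _*_; _+_)
import Data.Rational.Properties as ℚ
open NaturalArithmetic using (module Capacity)
open RationalArithmetic using (ℕtoℚ-mono-≤)
open SubsetSums using (sumIn; sumIn-⁅⁆)
open GreedyInvariant using (module Greedy)

lemma4p2 : Σ ℕ λ c → (n p : ℕ) → 1 ≤ p → p ≤ n → (fills : ℕ → Fills n) →
    GreedyPlay n p fills → (t : ℕ) → (i : Fin n) →
      fills t i ℚ.≤ ℕtoℚ (c * (p + ⌊log₂ n ⌋))
lemma4p2 = 3 , λ n p 1≤p _ fills play t i →
  let open Capacity n p
      open Greedy n p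
      open ℚ.≤-Reasoning
  in begin
    fills t i                   ≡⟨ sumIn-⁅⁆ i (fills t) ⟨
    sumIn ⁅ i ⁆ (fills t)       ≤⟨ Admissible.bounded (play-admissible fills play t) ⁅ i ⁆ ⟩
    ℕtoℚ (capacity ∣ ⁅ i ⁆ ∣)   ≡⟨ cong (ℕtoℚ ∘ capacity) (∣⁅x⁆∣≡1 i) ⟩
    ℕtoℚ (capacity 1)           ≤⟨ ℕtoℚ-mono-≤ (capacity-one 1≤p) ⟩
    ℕtoℚ (3 * (p + ⌊log₂ n ⌋))  ∎
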